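{- Let $X\subseteq\mathbb{N}^2$, fix $n\ge1$, and assume $(n+1,i)\in X$ and $(i,n+1)\notin X$ for every $i\in[n]$. Let $I=\{i_1<i_2<\cdots<i_\ell\}\subseteq[n]$ and define $I'=\{i_k: i_k-1\notin I\}$ and $I''=I'\setminus\{1\}$. For each $k\in[\ell]$ set \[ I_k=\{i_1,\dots,i_{k-1},\,i_k-1,\,i_{k+1}-1,\dots,i_\ell-1\}\setminus\{0\},\qquad \widehat{I}_k=\{i_1,\dots,i_{k-1},\,i_{k+1}-1,\dots,i_\ell-1\}\setminus\{0\}. \] Then \[ d_X(I;n+1)=d_X(I;n)+\sum_{i_k\in I''}d_X(I_k;n)+\sum_{i_k\in I'}d_X(\widehat{I}_k;n). \]
   Context: $[n]=\{1,\dots,n\}$. For $\pi=\pi_1\cdots\pi_N\in\mathfrak{S}_N$ (permutations of $[N]$ in one-line notation) and $X\subseteq\mathbb{N}^2$, $\mathrm{XDes}(\pi)=\{i\in[N-1]:(\pi_i,\pi_{i+1})\in X\}$. For a set $J$, $d_X(J;N)$ is the number of $\pi\in\mathfrak{S}_N$ with $\mathrm{XDes}(\pi)=J$. -}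

module Defs where

open import Data.Bool using (Bool; true; false; if_then_else_; not; _∧_)
open import Data.Nat using (ℕ; zero; suc; _+_; _∸_; _≡ᵇ_)
open import Data.List using (List; []; _∷_; _++_; map; concatMap; length; upTo; take; drop)
open import Data.Nat.ListAction using (sum)

bfilter : {A : Set} → (A → Bool) → List A → List A
bfilter p [] = []
bfilter p (a ∷ w) = if p a then a ∷ bfilter p w else bfilter p w

anyᵇ : {A : Set} → (A → Bool) → List A → Bool
anyᵇ p [] = false
anyᵇ p (a ∷ w) = if p a then true else anyᵇ p w

allᵇ : {A : Set} → (A → Bool) → List A → Bool
allᵇ p [] = true
allᵇ p (a ∷ w) = p a ∧ allᵇ p w

-- A subset X ⊆ ℕ² is given by its (Boolean) characteristic function.
Rel2 : Set
Rel2 = ℕ → ℕ → Bool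

-- Finite sets of naturals represented as lists; membership is Boolean.
_∈ᵇ_ : ℕ → List ℕ → Bool
i ∈ᵇ J = anyᵇ (λ j → i ≡ᵇ j) J

sameSet : List ℕ → List ℕ → Bool
sameSet A B = allᵇ (λ a → a ∈ᵇ B) A ∧ allᵇ (λ b → b ∈ᵇ A) B

range : ℕ → List ℕ
range n = map suc (upTo n)

words : ℕ → ℕ → List (List ℕ)
words N zero = [] ∷ []
words N (suc k) = concatMap (λ a → map (a ∷_) (words N k)) (range N)

distinct : List ℕ → Bool
distinct [] = true
distinct (a ∷ w) = not (a ∈ᵇ w) ∧ distinct w

-- 𝔖_N: permutations of [N] in one-line notation (injective words of length N over [N]).
perms : ℕ → List (List ℕ)
perms N = bfilter distinct (words N N)

-- XDes(π) = { i ∈ [N-1] : (π_i, π_{i+1}) ∈ X }, positions 1-based.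
xdesFrom : Rel2 → ℕ → List ℕ → List ℕ
xdesFrom X p [] = []
xdesFrom X p (a ∷ []) = []
xdesFrom X p (a ∷ b ∷ w) =
  if X a b then p ∷ xdesFrom X (suc p) (b ∷ w) else xdesFrom X (suc p) (b ∷ w)

XDes : Rel2 → List ℕ → List ℕ
XDes X π = xdesFrom X 1 π

dX : Rel2 → List ℕ → ℕ → ℕ
dX X J N = length (bfilter (λ π → sameSet (XDes X π) J) (perms N))

-- k-th element (0-based) of a list, default 0
at : List ℕ → ℕ → ℕ
at [] k = 0
at (a ∷ w) zero = a
at (a ∷ w) (suc k) = at w k

del0 : List ℕ → List ℕ
del0 = bfilter (λ j → not (j ≡ᵇ 0))

-- For I = (i_1,…,i_ℓ) and 0-based k (i.e. paper's index k+1):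
-- I_{k+1} = {i_1,…,i_k, i_{k+1}-1, …, i_ℓ-1} ∖ {0}
Ik : List ℕ → ℕ → List ℕ
Ik I k = del0 (take k I ++ map (λ j → j ∸ 1) (drop k I))

Ihat : List ℕ → ℕ → List ℕ
Ihat I k = del0 (take k I ++ map (λ j → j ∸ 1) (drop (suc k) I))

-- i ∈ I'  iff  i ∈ I and i-1 ∉ I   (for I ⊆ [n], 0 ∉ I so i=1 gives 1 ∈ I')
inI' : List ℕ → ℕ → Bool
inI' I i = i ∈ᵇ I ∧ not ((i ∸ 1) ∈ᵇ I)

inI'' : List ℕ → ℕ → Bool
inI'' I i = inI' I i ∧ not (i ≡ᵇ 1)

sumIk : Rel2 → List ℕ → ℕ → ℕ
sumIk X I n = sum (map (λ k → if inI'' I (at I k) then dX X (Ik I k) n else 0) (upTo (length I)))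

sumIhat : Rel2 → List ℕ → ℕ → ℕ
sumIhat X I n = sum (map (λ k → if inI' I (at I k) then dX X (Ihat I k) n else 0) (upTo (length I)))

module Submission where

-- Every permutation of [n + 1] arises from exactly one permutation σ of [n] by inserting n + 1
-- into one of the slots j = 0, …, n.  Since (n + 1, i) ∈ X and (i, n + 1) ∉ X, inserting n + 1
-- into slot j < n leaves the X-descents of σ at positions below j alone, makes j a non-descent
-- and j + 1 a descent, destroys the pair of σ at position j and shifts all positions above it
-- up by one; slot n changes nothing, which gives the term d_X(I; n).  For j < n the insertion
-- has descent set I only if j + 1 = i_k ∈ I and j ∉ I, that is i_k ∈ I′, and then exactly when
-- XDes(σ) agrees with I below j and with I − 1 above j.  Position j of σ is free: it is not a
-- descent precisely for the σ counted by d_X(Î_k; n), and it is a descent, which needs j ≥ 1,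
-- i.e. i_k ∈ I″, precisely for those counted by d_X(I_k; n).

open import Defs

open import Algebra.Properties.CommutativeSemigroup using (interchange)
open import Data.Bool using (Bool; true; false; if_then_else_; not; _∧_; _∨_)
open import Data.Bool.Properties using (⇔→≡; ∨-identityʳ; ∨-zeroʳ; ∧-identityʳ; ∧-zeroʳ)
open import Data.List
  using (List; []; _∷_; _++_; map; length; upTo; applyUpTo; take; drop; concatMap; filter; filterᵇ)
open import Data.List.Properties
  using ( map-cong; map-cong-local; map-∘; map-upTo; take++drop≡id; length-map; length-upTo
        ; length-++-≤ˡ; length-filter; ∷-injectiveˡ; ∷-injectiveʳ)
open import Data.List.Membership.Propositional using (_∈_; _∉_; find; lose)
open import Data.List.Membership.Propositional.Properties
  using ( ∈-∃++; ∈-++⁺ʳ; ∈-map⁺; ∈-map⁻; ∈-upTo⁺; ∈-upTo⁻; ∈-filter⁺; ∈-filter⁻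
        ; ∈-concatMap⁺; ∈-concatMap⁻)
open import Data.List.Membership.Propositional.Properties.WithK using (unique∧set⇒bag)
open import Data.List.Relation.Binary.BagAndSetEquality using (∼bag⇒↭)
open import Data.List.Relation.Binary.Permutation.Propositional using (_↭_)
open import Data.List.Relation.Binary.Permutation.Propositional.Properties
  using (↭-length; filter-↭; map⁺)
open import Data.List.Relation.Unary.All using (All; []; _∷_)
import Data.List.Relation.Unary.All as All
open import Data.List.Relation.Unary.All.Properties using (¬Any⇒All¬; All¬⇒¬Any)
  renaming (drop⁺ to All-drop⁺)
open import Data.List.Relation.Unary.AllPairs using (AllPairs; []; _∷_)
import Data.List.Relation.Unary.AllPairs as AllPairs
open import Data.List.Relation.Unary.Any using (here; there)
open import Data.List.Relation.Unary.Linked using (Linked)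
open import Data.List.Relation.Unary.Linked.Properties using (Linked⇒AllPairs)
open import Data.List.Relation.Unary.Unique.Propositional using (Unique)
import Data.List.Relation.Unary.Unique.Propositional.Properties as Unique
open import Data.Nat using (ℕ; zero; suc; _+_; _∸_; _≡ᵇ_; _≤_; _<_; z≤n; s≤s; s≤s⁻¹; _≟_)
open import Data.List.Membership.DecPropositional _≟_ using (_∈?_)
open import Data.Nat.ListAction using (sum)
open import Data.Nat.ListAction.Properties using (sum-↭)
open import Data.Nat.Properties
  using ( +-commutativeSemigroup; +-suc; +-assoc; +-comm; +-identityʳ; suc-injective
        ; ≤-refl; ≤-trans; <-trans; <-≤-trans; ≤-<-trans; <-irrefl; <-cmp; <⇒≢; >⇒≢; <⇒≤; ≤∧≢⇒<
        ; n<1+n; m≤m+n; m≤n⇒m≤1+n; m<n⇒m<1+n; m≤n⇒m<n∨m≡n; 1+n≰n; module ≤-Reasoning)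
open import Data.Product using (_×_; _,_; proj₁; proj₂; map₁; uncurry)
open import Data.Sum using (inj₁; inj₂)
open import Function using (_∘_)
open import Function.Bundles using (Equivalence; _⇔_; mk⇔)
open import Relation.Binary using (tri<; tri≈; tri>)
open import Relation.Binary.PropositionalEquality
  using (_≡_; _≢_; refl; sym; trans; cong; cong₂; subst; subst₂; module ≡-Reasoning)
open import Relation.Nullary using (¬_; contradiction)
open import Relation.Nullary.Decidable using (yes; no; does; dec-true; dec-false; T?)
open import Relation.Unary using (Decidable)


≡ᵇ-refl : (m : ℕ) → (m ≡ᵇ m) ≡ true
≡ᵇ-refl m = dec-true (m ≟ m) refl

≡ᵇ-≢ : {m n : ℕ} → m ≢ n → (m ≡ᵇ n) ≡ false
≡ᵇ-≢ {m} {n} = dec-false (m ≟ n)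

∈ᵇ≡does∈? : (i : ℕ) (w : List ℕ) → i ∈ᵇ w ≡ does (i ∈? w)
∈ᵇ≡does∈? i [] = refl
∈ᵇ≡does∈? i (a ∷ w) with i ≡ᵇ a
... | true  = refl
... | false = ∈ᵇ≡does∈? i w

∈⇒∈ᵇ : {i : ℕ} {w : List ℕ} → i ∈ w → i ∈ᵇ w ≡ true
∈⇒∈ᵇ {i} {w} i∈w = trans (∈ᵇ≡does∈? i w) (dec-true (i ∈? w) i∈w)

∉⇒∈ᵇ : {i : ℕ} {w : List ℕ} → i ∉ w → i ∈ᵇ w ≡ false
∉⇒∈ᵇ {i} {w} i∉w = trans (∈ᵇ≡does∈? i w) (dec-false (i ∈? w) i∉w)

∈ᵇ⇒∈ : {i : ℕ} {w : List ℕ} → i ∈ᵇ w ≡ true → i ∈ w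
∈ᵇ⇒∈ {i} {w} e with i ∈? w | ∈ᵇ≡does∈? i w
... | yes i∈w | _ = i∈w
... | no _    | e′ with () ← trans (sym e) e′

∈ᵇ≡false⇒∉ : {i : ℕ} {w : List ℕ} → i ∈ᵇ w ≡ false → i ∉ w
∈ᵇ≡false⇒∉ e i∈w with () ← trans (sym (∈⇒∈ᵇ i∈w)) e

All≢⇒∈ᵇ-false : {i : ℕ} {w : List ℕ} → All (i ≢_) w → i ∈ᵇ w ≡ false
All≢⇒∈ᵇ-false i≢w = ∉⇒∈ᵇ (All¬⇒¬Any i≢w)

∈ᵇ-∷ : (i a : ℕ) (w : List ℕ) → i ∈ᵇ (a ∷ w) ≡ (i ≡ᵇ a) ∨ i ∈ᵇ w
∈ᵇ-∷ i a w with i ≡ᵇ a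
... | true  = refl
... | false = refl

∈ᵇ-∷-≡ : (i : ℕ) (w : List ℕ) → i ∈ᵇ (i ∷ w) ≡ true
∈ᵇ-∷-≡ i w rewrite ≡ᵇ-refl i = refl

∈ᵇ-∷-≢ : {i a : ℕ} (w : List ℕ) → i ≢ a → i ∈ᵇ (a ∷ w) ≡ i ∈ᵇ w
∈ᵇ-∷-≢ w i≢a rewrite ≡ᵇ-≢ i≢a = refl

∈ᵇ-if-∷-≢ : (c : Bool) {i a : ℕ} (w : List ℕ) → i ≢ a → i ∈ᵇ (if c then a ∷ w else w) ≡ i ∈ᵇ w
∈ᵇ-if-∷-≢ true  w i≢a = ∈ᵇ-∷-≢ w i≢a
∈ᵇ-if-∷-≢ false w _   = refl

∈ᵇ-if-∷-≡ : (c : Bool) (i : ℕ) (w : List ℕ) → i ∈ᵇ w ≡ false → i ∈ᵇ (if c then i ∷ w else w) ≡ c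
∈ᵇ-if-∷-≡ true  i w _      = ∈ᵇ-∷-≡ i w
∈ᵇ-if-∷-≡ false i w i∉ᵇw = i∉ᵇw

∈ᵇ-++ : (i : ℕ) (A B : List ℕ) → i ∈ᵇ (A ++ B) ≡ i ∈ᵇ A ∨ i ∈ᵇ B
∈ᵇ-++ i []      B = refl
∈ᵇ-++ i (a ∷ A) B with i ≡ᵇ a
... | true  = refl
... | false = ∈ᵇ-++ i A B

∈ᵇ-map-pred : (i : ℕ) (A : List ℕ) → All (1 ≤_) A → i ∈ᵇ map (_∸ 1) A ≡ suc i ∈ᵇ A
∈ᵇ-map-pred i []          []            = refl
∈ᵇ-map-pred i (suc a ∷ A) (s≤s z≤n ∷ p) with i ≡ᵇ a
... | true  = refl
... | false = ∈ᵇ-map-pred i A p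

∈ᵇ-del0 : (i : ℕ) (A : List ℕ) → i ∈ᵇ del0 A ≡ not (i ≡ᵇ 0) ∧ i ∈ᵇ A
∈ᵇ-del0 zero    []          = refl
∈ᵇ-del0 (suc i) []          = refl
∈ᵇ-del0 zero    (zero  ∷ A) = ∈ᵇ-del0 zero A
∈ᵇ-del0 (suc i) (zero  ∷ A) = ∈ᵇ-del0 (suc i) A
∈ᵇ-del0 zero    (suc a ∷ A) = ∈ᵇ-del0 zero A
∈ᵇ-del0 (suc i) (suc a ∷ A) with i ≡ᵇ a
... | true  = refl
... | false = ∈ᵇ-del0 (suc i) A

∈ᵇ-del0-shift : (i : ℕ) (L R : List ℕ) → All (1 ≤_) R →
  i ∈ᵇ del0 (L ++ map (_∸ 1) R) ≡ not (i ≡ᵇ 0) ∧ (i ∈ᵇ L ∨ suc i ∈ᵇ R)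
∈ᵇ-del0-shift i L R R-pos = begin
  i ∈ᵇ del0 (L ++ map (_∸ 1) R)
    ≡⟨ ∈ᵇ-del0 i (L ++ map (_∸ 1) R) ⟩
  not (i ≡ᵇ 0) ∧ i ∈ᵇ (L ++ map (_∸ 1) R)
    ≡⟨ cong (not (i ≡ᵇ 0) ∧_) (∈ᵇ-++ i L (map (_∸ 1) R)) ⟩
  not (i ≡ᵇ 0) ∧ (i ∈ᵇ L ∨ i ∈ᵇ map (_∸ 1) R)
    ≡⟨ cong (λ b → not (i ≡ᵇ 0) ∧ (i ∈ᵇ L ∨ b)) (∈ᵇ-map-pred i R R-pos) ⟩
  not (i ≡ᵇ 0) ∧ (i ∈ᵇ L ∨ suc i ∈ᵇ R)
    ∎
  where open ≡-Reasoning

distinct⇒Unique : (w : List ℕ) → distinct w ≡ true → Unique w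
distinct⇒Unique []      _ = []
distinct⇒Unique (a ∷ w) e with a ∈ᵇ w in a∈w | distinct w in dw
... | false | true = ¬Any⇒All¬ w (∈ᵇ≡false⇒∉ a∈w) ∷ distinct⇒Unique w dw

Unique⇒distinct : (w : List ℕ) → Unique w → distinct w ≡ true
Unique⇒distinct []      _             = refl
Unique⇒distinct (a ∷ w) (a∉w ∷ uw) rewrite ∉⇒∈ᵇ (All¬⇒¬Any a∉w) = Unique⇒distinct w uw

∧≡true⁻ : {b c : Bool} → b ∧ c ≡ true → b ≡ true × c ≡ true
∧≡true⁻ {true} {true} _ = refl , refl

allᵇ⇒All : (p : ℕ → Bool) (A : List ℕ) → allᵇ p A ≡ true → All (λ a → p a ≡ true) A
allᵇ⇒All p []      _ = []
allᵇ⇒All p (a ∷ A) e with ∧≡true⁻ {p a} e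
... | pa , pA = pa ∷ allᵇ⇒All p A pA

All⇒allᵇ : (p : ℕ → Bool) (A : List ℕ) → All (λ a → p a ≡ true) A → allᵇ p A ≡ true
All⇒allᵇ p []      []         = refl
All⇒allᵇ p (a ∷ A) (pa ∷ pA) rewrite pa = All⇒allᵇ p A pA

_≐_ : List ℕ → List ℕ → Set
A ≐ B = ∀ d → d ∈ᵇ A ≡ d ∈ᵇ B

sameSet⇒≐ : (A B : List ℕ) → sameSet A B ≡ true → A ≐ B
sameSet⇒≐ A B e d with ∧≡true⁻ {allᵇ (_∈ᵇ B) A} e
... | A⊆B , B⊆A = ⇔→≡ (mk⇔
  (λ d∈A → All.lookup (allᵇ⇒All (_∈ᵇ B) A A⊆B) (∈ᵇ⇒∈ {d} {A} d∈A))
  (λ d∈B → All.lookup (allᵇ⇒All (_∈ᵇ A) B B⊆A) (∈ᵇ⇒∈ {d} {B} d∈B)))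

≐⇒sameSet : (A B : List ℕ) → A ≐ B → sameSet A B ≡ true
≐⇒sameSet A B A≐B
  rewrite All⇒allᵇ (_∈ᵇ B) A (All.tabulate (λ {d} d∈A → trans (sym (A≐B d)) (∈⇒∈ᵇ d∈A)))
        | All⇒allᵇ (_∈ᵇ A) B (All.tabulate (λ {d} d∈B → trans (A≐B d) (∈⇒∈ᵇ d∈B))) = refl

sameSet-≐ˡ : (A B C : List ℕ) → A ≐ B → sameSet A C ≡ sameSet B C
sameSet-≐ˡ A B C A≐B = ⇔→≡ (mk⇔
  (λ e → ≐⇒sameSet B C (λ d → trans (sym (A≐B d)) (sameSet⇒≐ A C e d)))
  (λ e → ≐⇒sameSet A C (λ d → trans (A≐B d) (sameSet⇒≐ B C e d))))

≡true-≡false⇒≢ : {a b : Bool} → a ≡ true → b ≡ false → a ≢ b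
≡true-≡false⇒≢ refl refl ()

sameSet-false : (A B : List ℕ) (d : ℕ) → d ∈ᵇ A ≢ d ∈ᵇ B → sameSet A B ≡ false
sameSet-false A B d differ with sameSet A B in e
... | true  = contradiction (sameSet⇒≐ A B e d) differ
... | false = refl

record AgreeOff (j : ℕ) (A B : List ℕ) : Set where
  constructor agreeOff
  field agree : ∀ e → e ≢ j → e ∈ᵇ A ≡ e ∈ᵇ B
open AgreeOff

module _ {j : ℕ} {A B : List ℕ} where

  ≐⇒AgreeOff : A ≐ B → AgreeOff j A B
  ≐⇒AgreeOff A≐B = agreeOff (λ e _ → A≐B e)

  AgreeOff⇒≐ : AgreeOff j A B → j ∈ᵇ A ≡ j ∈ᵇ B → A ≐ B
  AgreeOff⇒≐ A≈B at-j d with d ≟ j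
  ... | yes refl = at-j
  ... | no  d≢j  = agree A≈B d d≢j

AgreeOff-trans : {j : ℕ} {A B C : List ℕ} → AgreeOff j A B → AgreeOff j B C → AgreeOff j A C
AgreeOff-trans A≈B B≈C = agreeOff (λ e e≢j → trans (agree A≈B e e≢j) (agree B≈C e e≢j))

AgreeOff-sym : {j : ℕ} {A B : List ℕ} → AgreeOff j A B → AgreeOff j B A
AgreeOff-sym A≈B = agreeOff (λ e e≢j → sym (agree A≈B e e≢j))

count : {A : Set} → (A → Bool) → List A → ℕ
count p xs = length (bfilter p xs)

module _ {A : Set} where

  bfilter≡filterᵇ : (p : A → Bool) (xs : List A) → bfilter p xs ≡ filterᵇ p xs
  bfilter≡filterᵇ p []       = refl
  bfilter≡filterᵇ p (x ∷ xs) with p x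
  ... | true  = cong (x ∷_) (bfilter≡filterᵇ p xs)
  ... | false = bfilter≡filterᵇ p xs

  ∈-bfilter⁻ : (p : A → Bool) (xs : List A) {x : A} → x ∈ bfilter p xs → x ∈ xs × p x ≡ true
  ∈-bfilter⁻ p (y ∷ xs) x∈ with p y in py
  ∈-bfilter⁻ p (y ∷ xs) (here refl) | true = here refl , py
  ∈-bfilter⁻ p (y ∷ xs) (there x∈)  | true = map₁ there (∈-bfilter⁻ p xs x∈)
  ∈-bfilter⁻ p (y ∷ xs) x∈          | false = map₁ there (∈-bfilter⁻ p xs x∈)

  ∈-bfilter⁺ : (p : A → Bool) {xs : List A} {x : A} → x ∈ xs → p x ≡ true → x ∈ bfilter p xs
  ∈-bfilter⁺ p {y ∷ xs} (here refl) px rewrite px = here refl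
  ∈-bfilter⁺ p {y ∷ xs} (there x∈) px with p y
  ... | true  = there (∈-bfilter⁺ p x∈ px)
  ... | false = ∈-bfilter⁺ p x∈ px

  bfilter-Unique : (p : A → Bool) {xs : List A} → Unique xs → Unique (bfilter p xs)
  bfilter-Unique p {xs} u rewrite bfilter≡filterᵇ p xs = Unique.filter⁺ (T? ∘ p) u

  count-↭ : (p : A → Bool) {xs ys : List A} → xs ↭ ys → count p xs ≡ count p ys
  count-↭ p {xs} {ys} r rewrite bfilter≡filterᵇ p xs | bfilter≡filterᵇ p ys =
    ↭-length (filter-↭ (T? ∘ p) r)

  count-++ : (p : A → Bool) (xs ys : List A) → count p (xs ++ ys) ≡ count p xs + count p ys
  count-++ p []       ys = refl
  count-++ p (x ∷ xs) ys with p x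
  ... | true  = cong suc (count-++ p xs ys)
  ... | false = count-++ p xs ys

  count-cong : {p q : A → Bool} {xs : List A} → All (λ x → p x ≡ q x) xs → count p xs ≡ count q xs
  count-cong                      []            = refl
  count-cong {q = q} {x ∷ _} (px≡qx ∷ e) rewrite px≡qx with q x
  ... | true  = cong suc (count-cong e)
  ... | false = count-cong e

  count-none : {p : A → Bool} {xs : List A} → All (λ x → p x ≡ false) xs → count p xs ≡ 0
  count-none []              = refl
  count-none (px≡false ∷ e) rewrite px≡false = count-none e

  count-∨ : {p q : A → Bool} {xs : List A} → All (λ x → p x ∧ q x ≡ false) xs →
            count (λ x → p x ∨ q x) xs ≡ count p xs + count q xs
  count-∨ []                               = refl
  count-∨ {p} {q} {x ∷ xs} (disjoint ∷ e) with p x | q x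
  ... | true  | false = cong suc (count-∨ e)
  ... | false | true  = trans (cong suc (count-∨ e)) (sym (+-suc _ _))
  ... | false | false = count-∨ e

count-map : {A B : Set} (p : B → Bool) (f : A → B) (xs : List A) →
            count p (map f xs) ≡ count (p ∘ f) xs
count-map p f []       = refl
count-map p f (x ∷ xs) with p (f x)
... | true  = cong suc (count-map p f xs)
... | false = count-map p f xs

count-concatMap : {A B : Set} (p : B → Bool) (f : A → List B) (xs : List A) →
                  count p (concatMap f xs) ≡ sum (map (count p ∘ f) xs)
count-concatMap p f []       = refl
count-concatMap p f (x ∷ xs) =
  trans (count-++ p (f x) (concatMap f xs)) (cong (count p (f x) +_) (count-concatMap p f xs))

concatMap-Unique : {A B : Set} (f : A → List B) {xs : List A} → Unique xs → (∀ x → Unique (f x)) →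
  (∀ {x y z} → x ∈ xs → y ∈ xs → z ∈ f x → z ∈ f y → x ≡ y) → Unique (concatMap f xs)
concatMap-Unique f {[]}     _          _   _        = []
concatMap-Unique f {x ∷ xs} (x∉xs ∷ u) ufx disjoint =
  Unique.++⁺ (ufx x) (concatMap-Unique f u ufx (λ y∈ y′∈ → disjoint (there y∈) (there y′∈))) apart
  where
  apart : ∀ {z} → ¬ (z ∈ f x × z ∈ concatMap f xs)
  apart (z∈fx , z∈rest) with find (∈-concatMap⁻ f z∈rest)
  ... | y , y∈xs , z∈fy = All.lookup x∉xs y∈xs (disjoint (here refl) (there y∈xs) z∈fx z∈fy)

↭-unique : {A : Set} {xs ys : List A} → Unique xs → Unique ys →
  (∀ {x} → x ∈ xs → x ∈ ys) → (∀ {x} → x ∈ ys → x ∈ xs) → xs ↭ ys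
↭-unique uxs uys xs⊆ys ys⊆xs = ∼bag⇒↭ (unique∧set⇒bag uxs uys (mk⇔ xs⊆ys ys⊆xs))

filter-∈?-↭ : {xs ys : List ℕ} → Unique xs → Unique ys → All (_∈ ys) xs → filter (_∈? xs) ys ↭ xs
filter-∈?-↭ {xs} {ys} uxs uys xs⊆ys = ↭-unique (Unique.filter⁺ (_∈? xs) uys) uxs
  (λ x∈ → proj₂ (∈-filter⁻ (_∈? xs) {xs = ys} x∈))
  (λ x∈xs → ∈-filter⁺ (_∈? xs) (All.lookup xs⊆ys x∈xs) x∈xs)

Unique-⊆-length : {xs ys : List ℕ} → Unique xs → Unique ys → All (_∈ ys) xs → length xs ≤ length ys
Unique-⊆-length {xs} {ys} uxs uys xs⊆ys = begin
  length xs                   ≡⟨ ↭-length (filter-∈?-↭ uxs uys xs⊆ys) ⟨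
  length (filter (_∈? xs) ys) ≤⟨ length-filter (_∈? xs) ys ⟩
  length ys                   ∎
  where open ≤-Reasoning

sum-map-filter : {P : ℕ → Set} (P? : Decidable P) (f : ℕ → ℕ) (ys : List ℕ) →
  All (λ y → ¬ P y → f y ≡ 0) ys → sum (map f (filter P? ys)) ≡ sum (map f ys)
sum-map-filter P? f []       []              = refl
sum-map-filter P? f (y ∷ ys) (vanish ∷ rest) with P? y
... | yes _  = cong (f y +_) (sum-map-filter P? f ys rest)
... | no ¬py = trans (sum-map-filter P? f ys rest) (cong (_+ sum (map f ys)) (sym (vanish ¬py)))

sum-support : (f : ℕ → ℕ) {xs ys : List ℕ} → Unique xs → Unique ys → All (_∈ ys) xs →
  (∀ {y} → y ∈ ys → y ∉ xs → f y ≡ 0) → sum (map f ys) ≡ sum (map f xs)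
sum-support f {xs} {ys} uxs uys xs⊆ys vanish = begin
  sum (map f ys)                   ≡⟨ sum-map-filter (_∈? xs) f ys (All.tabulate vanish) ⟨
  sum (map f (filter (_∈? xs) ys)) ≡⟨ sum-↭ (map⁺ f (filter-∈?-↭ uxs uys xs⊆ys)) ⟩
  sum (map f xs)                   ∎
  where open ≡-Reasoning

sum-map-+ : (f g : ℕ → ℕ) (xs : List ℕ) →
  sum (map (λ x → f x + g x) xs) ≡ sum (map f xs) + sum (map g xs)
sum-map-+ f g []       = refl
sum-map-+ f g (x ∷ xs) = trans (cong (f x + g x +_) (sum-map-+ f g xs))
  (interchange +-commutativeSemigroup (f x) (g x) (sum (map f xs)) (sum (map g xs)))

-- Permutations of [N + 1] as insertions of N + 1

range-∈⁻ : {N a : ℕ} → a ∈ range N → 1 ≤ a × a ≤ N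
range-∈⁻ a∈ with ∈-map⁻ suc a∈
... | _ , x∈ , refl = s≤s z≤n , ∈-upTo⁻ x∈

range-∈⁺ : {N a : ℕ} → 1 ≤ a → a ≤ N → a ∈ range N
range-∈⁺ {a = suc a} _ a≤N = ∈-map⁺ suc (∈-upTo⁺ a≤N)

range-Unique : (N : ℕ) → Unique (range N)
range-Unique N = Unique.map⁺ suc-injective (Unique.upTo⁺ N)

length-range : (N : ℕ) → length (range N) ≡ N
length-range N = trans (length-map suc (upTo N)) (length-upTo N)

range-weaken : {n a : ℕ} → a ∈ range n → a ∈ range (suc n)
range-weaken a∈ with range-∈⁻ a∈
... | 1≤a , a≤n = range-∈⁺ 1≤a (m≤n⇒m≤1+n a≤n)

range-strengthen : {n a : ℕ} → a ∈ range (suc n) → a ≢ suc n → a ∈ range n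
range-strengthen a∈ a≢ with range-∈⁻ a∈
... | 1≤a , a≤1+n = range-∈⁺ 1≤a (s≤s⁻¹ (≤∧≢⇒< a≤1+n a≢))

words-∈⁻ : (N k : ℕ) {π : List ℕ} → π ∈ words N k → length π ≡ k × All (_∈ range N) π
words-∈⁻ N zero    (here refl) = refl , []
words-∈⁻ N (suc k) π∈ with find (∈-concatMap⁻ (λ a → map (a ∷_) (words N k)) {xs = range N} π∈)
... | a , a∈ , π∈′ with ∈-map⁻ (a ∷_) π∈′
... | ρ , ρ∈ , refl with words-∈⁻ N k ρ∈
... | |ρ| , ρ⊆ = cong suc |ρ| , a∈ ∷ ρ⊆

words-∈⁺ : (N : ℕ) {π : List ℕ} → All (_∈ range N) π → π ∈ words N (length π)
words-∈⁺ N []                  = here refl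
words-∈⁺ N {a ∷ π} (a∈ ∷ π⊆) =
  ∈-concatMap⁺ (λ b → map (b ∷_) (words N (length π))) (lose a∈ (∈-map⁺ (a ∷_) (words-∈⁺ N π⊆)))

words-Unique : (N k : ℕ) → Unique (words N k)
words-Unique N zero    = [] ∷ []
words-Unique N (suc k) =
  concatMap-Unique (λ a → map (a ∷_) (words N k)) (range-Unique N)
    (λ a → Unique.map⁺ ∷-injectiveʳ (words-Unique N k)) same-head
  where
  same-head : ∀ {a b π} → a ∈ range N → b ∈ range N →
    π ∈ map (a ∷_) (words N k) → π ∈ map (b ∷_) (words N k) → a ≡ b
  same-head _ _ π∈a π∈b with ∈-map⁻ _ π∈a | ∈-map⁻ _ π∈b
  ... | _ , _ , refl | _ , _ , e = ∷-injectiveˡ e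

record IsPerm (N : ℕ) (π : List ℕ) : Set where
  field
    length≡ : length π ≡ N
    ⊆range  : All (_∈ range N) π
    unique  : Unique π

perms-∈⁻ : (N : ℕ) {π : List ℕ} → π ∈ perms N → IsPerm N π
perms-∈⁻ N π∈ with ∈-bfilter⁻ distinct (words N N) π∈
... | π∈words , d with words-∈⁻ N N π∈words
... | l , ⊆r = record { length≡ = l ; ⊆range = ⊆r ; unique = distinct⇒Unique _ d }

perms-∈⁺ : (N : ℕ) {π : List ℕ} → IsPerm N π → π ∈ perms N
perms-∈⁺ N {π} p = ∈-bfilter⁺ distinct (subst (λ k → π ∈ words N k) length≡ (words-∈⁺ N ⊆range))
                                        (Unique⇒distinct π unique)
  where open IsPerm p

perms-Unique : (N : ℕ) → Unique (perms N)
perms-Unique N = bfilter-Unique distinct (words-Unique N N)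

max∉perm : {n : ℕ} {σ : List ℕ} → IsPerm n σ → suc n ∉ σ
max∉perm p n+1∈σ = 1+n≰n (proj₂ (range-∈⁻ (All.lookup (IsPerm.⊆range p) n+1∈σ)))

-- Pigeonhole: otherwise π would be a duplicate-free list of n + 1 letters from [n].
max∈perm : {n : ℕ} {π : List ℕ} → IsPerm (suc n) π → suc n ∈ π
max∈perm {n} {π} p with suc n ∈? π
... | yes n+1∈π = n+1∈π
... | no  n+1∉π = contradiction π-fits 1+n≰n
  where
  open IsPerm p
  π-fits : suc n ≤ n
  π-fits = subst₂ _≤_ length≡ (length-range n)
    (Unique-⊆-length unique (range-Unique n)
      (All.tabulate (λ {x} x∈π →
        range-strengthen (All.lookup ⊆range x∈π) (λ { refl → n+1∉π x∈π }))))

insertAt : {A : Set} → A → ℕ → List A → List A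
insertAt x zero    ys       = x ∷ ys
insertAt x (suc j) []       = x ∷ []
insertAt x (suc j) (y ∷ ys) = y ∷ insertAt x j ys

module _ {A : Set} where

  length-insertAt : (x : A) (j : ℕ) (ys : List A) → length (insertAt x j ys) ≡ suc (length ys)
  length-insertAt x zero    ys       = refl
  length-insertAt x (suc j) []       = refl
  length-insertAt x (suc j) (y ∷ ys) = cong suc (length-insertAt x j ys)

  All-insertAt : {P : A → Set} {x : A} (j : ℕ) {ys : List A} →
    P x → All P ys → All P (insertAt x j ys)
  All-insertAt zero    px pys         = px ∷ pys
  All-insertAt (suc j) px []          = px ∷ []
  All-insertAt (suc j) px (py ∷ pys) = py ∷ All-insertAt j px pys

  Unique-insertAt : {x : A} (j : ℕ) {ys : List A} → x ∉ ys → Unique ys → Unique (insertAt x j ys)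
  Unique-insertAt zero            x∉ys u          = ¬Any⇒All¬ _ x∉ys ∷ u
  Unique-insertAt (suc j) {[]}     _    _          = [] ∷ []
  Unique-insertAt (suc j) {y ∷ ys} x∉ys (y∉ys ∷ u) =
    All-insertAt j (λ y≡x → x∉ys (here (sym y≡x))) y∉ys ∷ Unique-insertAt j (x∉ys ∘ there) u

  All-insertAt⁻ : {P : A → Set} {x : A} (j : ℕ) {ys : List A} →
    All P (insertAt x j ys) → P x × All P ys
  All-insertAt⁻ zero            (px ∷ pys) = px , pys
  All-insertAt⁻ (suc j) {[]}     (px ∷ [])  = px , []
  All-insertAt⁻ (suc j) {y ∷ ys} (py ∷ pys) with All-insertAt⁻ j pys
  ... | px , pys′ = px , py ∷ pys′

  Unique-insertAt⁻ : {x : A} (j : ℕ) {ys : List A} → Unique (insertAt x j ys) → x ∉ ys × Unique ys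
  Unique-insertAt⁻ zero            (x∉ ∷ u) = All¬⇒¬Any x∉ , u
  Unique-insertAt⁻ (suc j) {[]}     _        = (λ ()) , []
  Unique-insertAt⁻ (suc j) {y ∷ ys} (y∉ ∷ u)
    with Unique-insertAt⁻ j u | All-insertAt⁻ j y∉
  ... | x∉ys , uys | y≢x , y∉ys = x∉y∷ys , y∉ys ∷ uys
    where
    x∉y∷ys : _ ∉ y ∷ ys
    x∉y∷ys (here x≡y)  = y≢x (sym x≡y)
    x∉y∷ys (there x∈ys) = x∉ys x∈ys

  insertAt-++ : (x : A) (ys zs : List A) → insertAt x (length ys) (ys ++ zs) ≡ ys ++ x ∷ zs
  insertAt-++ x []       zs = refl
  insertAt-++ x (y ∷ ys) zs = cong (y ∷_) (insertAt-++ x ys zs)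

  insertAt-injectiveʳ : (x : A) (j : ℕ) {ys zs : List A} →
    insertAt x j ys ≡ insertAt x j zs → ys ≡ zs
  insertAt-injectiveʳ x zero    e = ∷-injectiveʳ e
  insertAt-injectiveʳ x (suc j) {[]}     {[]}     e = refl
  insertAt-injectiveʳ x (suc j) {[]}     {z ∷ zs} e
    with () ← trans (cong length (∷-injectiveʳ e)) (length-insertAt x j zs)
  insertAt-injectiveʳ x (suc j) {y ∷ ys} {[]}     e
    with () ← trans (cong length (sym (∷-injectiveʳ e))) (length-insertAt x j ys)
  insertAt-injectiveʳ x (suc j) {y ∷ ys} {z ∷ zs} e =
    cong₂ _∷_ (∷-injectiveˡ e) (insertAt-injectiveʳ x j (∷-injectiveʳ e))

  insertAt-injectiveˡ : (x : A) {i j : ℕ} {ys zs : List A} → x ∉ ys → x ∉ zs →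
    i ≤ length ys → j ≤ length zs → insertAt x i ys ≡ insertAt x j zs → i ≡ j
  insertAt-injectiveˡ x {zero}  {zero}              _    _    _         _         _ = refl
  insertAt-injectiveˡ x {zero}  {suc j} {zs = _ ∷ _} _    x∉zs _         _         e =
    contradiction (here (∷-injectiveˡ e)) x∉zs
  insertAt-injectiveˡ x {suc i} {zero}  {_ ∷ _}     x∉ys _    _         _         e =
    contradiction (here (sym (∷-injectiveˡ e))) x∉ys
  insertAt-injectiveˡ x {suc i} {suc j} {_ ∷ _} {_ ∷ _} x∉ys x∉zs (s≤s i≤) (s≤s j≤) e =
    cong suc (insertAt-injectiveˡ x (x∉ys ∘ there) (x∉zs ∘ there) i≤ j≤ (∷-injectiveʳ e))

insertAt-IsPerm : {n : ℕ} {σ : List ℕ} (j : ℕ) → IsPerm n σ → IsPerm (suc n) (insertAt (suc n) j σ)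
insertAt-IsPerm {n} {σ} j p = record
  { length≡ = trans (length-insertAt (suc n) j σ) (cong suc length≡)
  ; ⊆range  = All-insertAt j (range-∈⁺ (s≤s z≤n) ≤-refl) (All.map range-weaken ⊆range)
  ; unique  = Unique-insertAt j (max∉perm p) unique
  }
  where open IsPerm p

insertAt-IsPerm⁻ : {n : ℕ} {σ : List ℕ} (j : ℕ) → IsPerm (suc n) (insertAt (suc n) j σ) → IsPerm n σ
insertAt-IsPerm⁻ {n} {σ} j p = record
  { length≡ = suc-injective (trans (sym (length-insertAt (suc n) j σ)) length≡)
  ; ⊆range  = All.tabulate (λ {x} x∈σ →
      range-strengthen (All.lookup σ⊆ x∈σ) (λ { refl → proj₁ σ-unique x∈σ }))
  ; unique  = proj₂ σ-unique
  }
  where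
  open IsPerm p
  σ-unique : suc n ∉ σ × Unique σ
  σ-unique = Unique-insertAt⁻ j unique
  σ⊆ : All (_∈ range (suc n)) σ
  σ⊆ = proj₂ (All-insertAt⁻ j ⊆range)

slots : ℕ → List ℕ
slots n = n ∷ upTo n

∈-slots⁻ : {n j : ℕ} → j ∈ slots n → j ≤ n
∈-slots⁻ (here refl) = ≤-refl
∈-slots⁻ (there j∈)  = <⇒≤ (∈-upTo⁻ j∈)

slots-Unique : (n : ℕ) → Unique (slots n)
slots-Unique n = All.tabulate (λ n∈ → λ { refl → <-irrefl refl (∈-upTo⁻ n∈) }) ∷ Unique.upTo⁺ n

insertions : ℕ → List (List ℕ)
insertions n = concatMap (λ j → map (insertAt (suc n) j) (perms n)) (slots n)

insertions-Unique : (n : ℕ) → Unique (insertions n)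
insertions-Unique n = concatMap-Unique _ (slots-Unique n)
  (λ j → Unique.map⁺ (insertAt-injectiveʳ (suc n) j) (perms-Unique n)) same-slot
  where
  same-slot : ∀ {i j π} → i ∈ slots n → j ∈ slots n →
    π ∈ map (insertAt (suc n) i) (perms n) → π ∈ map (insertAt (suc n) j) (perms n) → i ≡ j
  same-slot i∈ j∈ π∈ π∈′ with ∈-map⁻ _ π∈ | ∈-map⁻ _ π∈′
  ... | σ , σ∈ , refl | τ , τ∈ , e with perms-∈⁻ n σ∈ | perms-∈⁻ n τ∈
  ... | pσ | pτ = insertAt-injectiveˡ (suc n) (max∉perm pσ) (max∉perm pτ)
    (subst (_ ≤_) (sym (IsPerm.length≡ pσ)) (∈-slots⁻ i∈))
    (subst (_ ≤_) (sym (IsPerm.length≡ pτ)) (∈-slots⁻ j∈)) e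

perms-suc-↭ : (n : ℕ) → perms (suc n) ↭ insertions n
perms-suc-↭ n = ↭-unique (perms-Unique (suc n)) (insertions-Unique n) ⊆insertions ⊇insertions
  where
  ⊆insertions : ∀ {π} → π ∈ perms (suc n) → π ∈ insertions n
  ⊆insertions {π} π∈ with ∈-∃++ (max∈perm (perms-∈⁻ (suc n) π∈))
  ... | ys , zs , refl =
    subst (_∈ insertions n) π≡ (∈-concatMap⁺ _ (lose j∈ (∈-map⁺ (insertAt (suc n) j) σ∈)))
    where
    j : ℕ
    j = length ys
    π≡ : insertAt (suc n) j (ys ++ zs) ≡ ys ++ suc n ∷ zs
    π≡ = insertAt-++ (suc n) ys zs
    pσ : IsPerm n (ys ++ zs)
    pσ = insertAt-IsPerm⁻ j (subst (IsPerm (suc n)) (sym π≡) (perms-∈⁻ (suc n) π∈))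
    σ∈ : ys ++ zs ∈ perms n
    σ∈ = perms-∈⁺ n pσ
    j∈ : j ∈ slots n
    j∈ with j ≟ n
    ... | yes j≡n = here j≡n
    ... | no  j≢n = there (∈-upTo⁺ (≤∧≢⇒< j≤n j≢n))
      where
      j≤n : j ≤ n
      j≤n = subst (j ≤_) (IsPerm.length≡ pσ) (length-++-≤ˡ ys)
  ⊇insertions : ∀ {π} → π ∈ insertions n → π ∈ perms (suc n)
  ⊇insertions π∈ with find (∈-concatMap⁻ _ {xs = slots n} π∈)
  ... | j , _ , π∈′ with ∈-map⁻ _ π∈′
  ... | σ , σ∈ , refl = perms-∈⁺ (suc n) (insertAt-IsPerm j (perms-∈⁻ n σ∈))

count-perms-suc : (p : List ℕ → Bool) (n : ℕ) →
  count p (perms (suc n)) ≡ count (p ∘ insertAt (suc n) n) (perms n)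
                          + sum (map (λ j → count (p ∘ insertAt (suc n) j) (perms n)) (upTo n))
count-perms-suc p n = begin
  count p (perms (suc n))
    ≡⟨ count-↭ p (perms-suc-↭ n) ⟩
  count p (insertions n)
    ≡⟨ count-concatMap p (λ j → map (insertAt (suc n) j) (perms n)) (slots n) ⟩
  sum (map (λ j → count p (map (insertAt (suc n) j) (perms n))) (slots n))
    ≡⟨ cong sum (map-cong (λ j → count-map p (insertAt (suc n) j) (perms n)) (slots n)) ⟩
  sum (map (λ j → count (p ∘ insertAt (suc n) j) (perms n)) (slots n))
    ∎
  where open ≡-Reasoning

-- Descent sets under insertion of a top letter

-- Positions are 0-based here: xdesAt X σ m tests the pair (σ_{m+1}, σ_{m+2}), i.e. position m + 1
-- of XDes.
xdesAt : Rel2 → List ℕ → ℕ → Bool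
xdesAt X (a ∷ b ∷ w) zero    = X a b
xdesAt X (a ∷ b ∷ w) (suc m) = xdesAt X (b ∷ w) m
xdesAt X _           _       = false

xdesAt-∷ : (X : Rel2) (a : ℕ) (w : List ℕ) (m : ℕ) → xdesAt X (a ∷ w) (suc m) ≡ xdesAt X w m
xdesAt-∷ X a []      m = refl
xdesAt-∷ X a (b ∷ w) m = refl

∈ᵇ-xdesFrom-below : (X : Rel2) (p : ℕ) (σ : List ℕ) {d : ℕ} → d < p → d ∈ᵇ xdesFrom X p σ ≡ false
∈ᵇ-xdesFrom-below X p []          d<p = refl
∈ᵇ-xdesFrom-below X p (a ∷ [])    d<p = refl
∈ᵇ-xdesFrom-below X p (a ∷ b ∷ σ) d<p =
  trans (∈ᵇ-if-∷-≢ (X a b) (xdesFrom X (suc p) (b ∷ σ)) (<⇒≢ d<p))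
        (∈ᵇ-xdesFrom-below X (suc p) (b ∷ σ) (m≤n⇒m≤1+n d<p))

∈ᵇ-xdesFrom : (X : Rel2) (p : ℕ) (σ : List ℕ) (m : ℕ) → (p + m) ∈ᵇ xdesFrom X p σ ≡ xdesAt X σ m
∈ᵇ-xdesFrom X p []          m       = refl
∈ᵇ-xdesFrom X p (a ∷ [])    m       = refl
∈ᵇ-xdesFrom X p (a ∷ b ∷ σ) zero    rewrite +-identityʳ p =
  ∈ᵇ-if-∷-≡ (X a b) p _ (∈ᵇ-xdesFrom-below X (suc p) (b ∷ σ) (n<1+n p))
∈ᵇ-xdesFrom X p (a ∷ b ∷ σ) (suc m) rewrite +-suc p m =
  trans (∈ᵇ-if-∷-≢ (X a b) (xdesFrom X (suc p) (b ∷ σ)) (>⇒≢ (s≤s (m≤m+n p m))))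
        (∈ᵇ-xdesFrom X (suc p) (b ∷ σ) m)

zero-∈ᵇ-XDes : (X : Rel2) (σ : List ℕ) → 0 ∈ᵇ XDes X σ ≡ false
zero-∈ᵇ-XDes X σ = ∈ᵇ-xdesFrom-below X 1 σ (s≤s z≤n)

suc-∈ᵇ-XDes : (X : Rel2) (σ : List ℕ) (m : ℕ) → suc m ∈ᵇ XDes X σ ≡ xdesAt X σ m
suc-∈ᵇ-XDes X σ m = ∈ᵇ-xdesFrom X 1 σ m

Above : Rel2 → ℕ → ℕ → Set
Above X M a = X M a ≡ true × X a M ≡ false

module _ (X : Rel2) (M : ℕ) where

  xdesAt-insertAt-before : {σ : List ℕ} → All (Above X M) σ → (j m : ℕ) → suc m < j →
    xdesAt X (insertAt M j σ) m ≡ xdesAt X σ m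
  xdesAt-insertAt-before {[]}    _ (suc j) m _ = refl
  xdesAt-insertAt-before {a ∷ []}    (top ∷ _) (suc (suc j)) zero _ = proj₂ top
  xdesAt-insertAt-before {a ∷ b ∷ σ} _         (suc (suc j)) zero _ = refl
  xdesAt-insertAt-before {a ∷ σ} (_ ∷ tops) (suc j) (suc m) (s≤s m<j) = begin
    xdesAt X (a ∷ insertAt M j σ) (suc m) ≡⟨ xdesAt-∷ X a (insertAt M j σ) m ⟩
    xdesAt X (insertAt M j σ) m           ≡⟨ xdesAt-insertAt-before tops j m m<j ⟩
    xdesAt X σ m                          ≡⟨ xdesAt-∷ X a σ m ⟨
    xdesAt X (a ∷ σ) (suc m)              ∎
    where open ≡-Reasoning

  xdesAt-insertAt-left : {σ : List ℕ} → All (Above X M) σ → (j : ℕ) → j < length σ →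
    xdesAt X (insertAt M (suc j) σ) j ≡ false
  xdesAt-insertAt-left {a ∷ σ} (top ∷ _)    zero    _         = proj₂ top
  xdesAt-insertAt-left {a ∷ σ} (_   ∷ tops) (suc j) (s≤s j<) =
    trans (xdesAt-∷ X a (insertAt M (suc j) σ) j) (xdesAt-insertAt-left tops j j<)

  xdesAt-insertAt-right : {σ : List ℕ} → All (Above X M) σ → (j : ℕ) → j < length σ →
    xdesAt X (insertAt M j σ) j ≡ true
  xdesAt-insertAt-right {a ∷ σ} (top ∷ _)    zero    _         = proj₁ top
  xdesAt-insertAt-right {a ∷ σ} (_   ∷ tops) (suc j) (s≤s j<) =
    trans (xdesAt-∷ X a (insertAt M j σ) j) (xdesAt-insertAt-right tops j j<)

  xdesAt-insertAt-after : (σ : List ℕ) {j e : ℕ} → j ≤ e →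
    xdesAt X (insertAt M j σ) (suc e) ≡ xdesAt X σ e
  xdesAt-insertAt-after σ       {zero}           _          = xdesAt-∷ X M σ _
  xdesAt-insertAt-after []      {suc j}          _          = refl
  xdesAt-insertAt-after (a ∷ σ) {suc j} {suc e} (s≤s j≤e) = begin
    xdesAt X (a ∷ insertAt M j σ) (suc (suc e)) ≡⟨ xdesAt-∷ X a (insertAt M j σ) (suc e) ⟩
    xdesAt X (insertAt M j σ) (suc e)           ≡⟨ xdesAt-insertAt-after σ j≤e ⟩
    xdesAt X σ e                                ≡⟨ xdesAt-∷ X a σ e ⟨
    xdesAt X (a ∷ σ) (suc e)                    ∎
    where open ≡-Reasoning

  xdesAt-insertAt-end : {σ : List ℕ} → All (Above X M) σ → (m : ℕ) →
    xdesAt X (insertAt M (length σ) σ) m ≡ xdesAt X σ m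
  xdesAt-insertAt-end {[]}        _          m       = refl
  xdesAt-insertAt-end {a ∷ []}    (top ∷ _)  zero    = proj₂ top
  xdesAt-insertAt-end {a ∷ b ∷ σ} _          zero    = refl
  xdesAt-insertAt-end {a ∷ σ}     (_ ∷ tops) (suc m) = begin
    xdesAt X (a ∷ insertAt M (length σ) σ) (suc m) ≡⟨ xdesAt-∷ X a (insertAt M (length σ) σ) m ⟩
    xdesAt X (insertAt M (length σ) σ) m           ≡⟨ xdesAt-insertAt-end tops m ⟩
    xdesAt X σ m                                   ≡⟨ xdesAt-∷ X a σ m ⟨
    xdesAt X (a ∷ σ) (suc m)                       ∎
    where open ≡-Reasoning

module _ (X : Rel2) (M : ℕ) {σ : List ℕ} (tops : All (Above X M) σ) where

  XDes-insertAt-below : {d j : ℕ} → d < j → d ∈ᵇ XDes X (insertAt M j σ) ≡ d ∈ᵇ XDes X σ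
  XDes-insertAt-below {zero}  {j} _   =
    trans (zero-∈ᵇ-XDes X (insertAt M j σ)) (sym (zero-∈ᵇ-XDes X σ))
  XDes-insertAt-below {suc m} {j} m<j = begin
    suc m ∈ᵇ XDes X (insertAt M j σ) ≡⟨ suc-∈ᵇ-XDes X (insertAt M j σ) m ⟩
    xdesAt X (insertAt M j σ) m      ≡⟨ xdesAt-insertAt-before X M tops j m m<j ⟩
    xdesAt X σ m                     ≡⟨ suc-∈ᵇ-XDes X σ m ⟨
    suc m ∈ᵇ XDes X σ                ∎
    where open ≡-Reasoning

  XDes-insertAt-at : {j : ℕ} → j ≤ length σ → j ∈ᵇ XDes X (insertAt M j σ) ≡ false
  XDes-insertAt-at {zero}  _   = zero-∈ᵇ-XDes X (insertAt M 0 σ)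
  XDes-insertAt-at {suc j} j< =
    trans (suc-∈ᵇ-XDes X (insertAt M (suc j) σ) j) (xdesAt-insertAt-left X M tops j j<)

  XDes-insertAt-next : {j : ℕ} → j < length σ → suc j ∈ᵇ XDes X (insertAt M j σ) ≡ true
  XDes-insertAt-next {j} j< =
    trans (suc-∈ᵇ-XDes X (insertAt M j σ) j) (xdesAt-insertAt-right X M tops j j<)

  XDes-insertAt-above : {j e : ℕ} → j < e → suc e ∈ᵇ XDes X (insertAt M j σ) ≡ e ∈ᵇ XDes X σ
  XDes-insertAt-above {j} {suc e} (s≤s j≤e) =
    trans (suc-∈ᵇ-XDes X (insertAt M j σ) (suc e))
          (trans (xdesAt-insertAt-after X M σ j≤e) (sym (suc-∈ᵇ-XDes X σ e)))

  XDes-insertAt-end : XDes X (insertAt M (length σ) σ) ≐ XDes X σ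
  XDes-insertAt-end zero    =
    trans (zero-∈ᵇ-XDes X (insertAt M (length σ) σ)) (sym (zero-∈ᵇ-XDes X σ))
  XDes-insertAt-end (suc m) = begin
    suc m ∈ᵇ XDes X (insertAt M (length σ) σ) ≡⟨ suc-∈ᵇ-XDes X (insertAt M (length σ) σ) m ⟩
    xdesAt X (insertAt M (length σ) σ) m      ≡⟨ xdesAt-insertAt-end X M tops m ⟩
    xdesAt X σ m                              ≡⟨ suc-∈ᵇ-XDes X σ m ⟨
    suc m ∈ᵇ XDes X σ                         ∎
    where open ≡-Reasoning

module _ (X : Rel2) (M : ℕ) {σ : List ℕ} (tops : All (Above X M) σ) {j : ℕ} (j< : j < length σ)
         (I S : List ℕ) (j∉I : j ∈ᵇ I ≡ false) (j+1∈I : suc j ∈ᵇ I ≡ true)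
         (lo : ∀ e → e < j → e ∈ᵇ S ≡ e ∈ᵇ I) (hi : ∀ e → j < e → e ∈ᵇ S ≡ suc e ∈ᵇ I) where

  XDes-insertAt-≐⇒AgreeOff : XDes X (insertAt M j σ) ≐ I → AgreeOff j (XDes X σ) S
  XDes-insertAt-≐⇒AgreeOff τ≐I = agreeOff agreement
    where
    agreement : ∀ e → e ≢ j → e ∈ᵇ XDes X σ ≡ e ∈ᵇ S
    agreement e e≢j with <-cmp e j
    ... | tri< e<j _ _ =
      trans (sym (XDes-insertAt-below X M tops e<j)) (trans (τ≐I e) (sym (lo e e<j)))
    ... | tri≈ _ e≡j _ = contradiction e≡j e≢j
    ... | tri> _ _ j<e =
      trans (sym (XDes-insertAt-above X M tops j<e)) (trans (τ≐I (suc e)) (sym (hi e j<e)))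

  AgreeOff⇒XDes-insertAt-≐ : AgreeOff j (XDes X σ) S → XDes X (insertAt M j σ) ≐ I
  AgreeOff⇒XDes-insertAt-≐ σ≈S d with <-cmp d j
  ... | tri< d<j _ _ =
    trans (XDes-insertAt-below X M tops d<j) (trans (agree σ≈S d (<⇒≢ d<j)) (lo d d<j))
  ... | tri≈ _ refl _ = trans (XDes-insertAt-at X M tops (<⇒≤ j<)) (sym j∉I)
  AgreeOff⇒XDes-insertAt-≐ σ≈S (suc d) | tri> _ _ (s≤s j≤d) with m≤n⇒m<n∨m≡n j≤d
  ... | inj₂ refl = trans (XDes-insertAt-next X M tops j<) (sym j+1∈I)
  ... | inj₁ j<d  =
    trans (XDes-insertAt-above X M tops j<d) (trans (agree σ≈S d (>⇒≢ j<d)) (hi d j<d))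

-- Counting by insertion slot

module SlotCount (X : Rel2) (n : ℕ) (H : ∀ i → 1 ≤ i → i ≤ n → Above X (suc n) i) (I : List ℕ) where

  Q : ℕ → List ℕ → Bool
  Q j σ = sameSet (XDes X (insertAt (suc n) j σ)) I

  c : ℕ → ℕ
  c j = count (Q j) (perms n)

  perm-tops : {σ : List ℕ} → σ ∈ perms n → All (Above X (suc n)) σ
  perm-tops σ∈ = All.map (λ a∈ → uncurry (H _) (range-∈⁻ a∈)) (IsPerm.⊆range (perms-∈⁻ n σ∈))

  perm-length : {σ : List ℕ} → σ ∈ perms n → length σ ≡ n
  perm-length σ∈ = IsPerm.length≡ (perms-∈⁻ n σ∈)

  ≤-length : {σ : List ℕ} {j : ℕ} → σ ∈ perms n → j ≤ n → j ≤ length σ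
  ≤-length σ∈ = subst (_ ≤_) (sym (perm-length σ∈))

  c-last : c n ≡ dX X I n
  c-last = count-cong (All.tabulate (λ {σ} σ∈ →
    sameSet-≐ˡ (XDes X (insertAt (suc n) n σ)) (XDes X σ) I
      (subst (λ k → XDes X (insertAt (suc n) k σ) ≐ XDes X σ) (perm-length σ∈)
             (XDes-insertAt-end X (suc n) (perm-tops σ∈)))))

  c-vanish-next : {j : ℕ} → j < n → suc j ∈ᵇ I ≡ false → c j ≡ 0
  c-vanish-next {j} j<n j+1∉I = count-none (All.tabulate (λ {σ} σ∈ →
    sameSet-false (XDes X (insertAt (suc n) j σ)) I (suc j)
      (≡true-≡false⇒≢ (XDes-insertAt-next X (suc n) (perm-tops σ∈) (≤-length σ∈ j<n)) j+1∉I)))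

  c-vanish-at : {j : ℕ} → j ≤ n → j ∈ᵇ I ≡ true → c j ≡ 0
  c-vanish-at {j} j≤n j∈I = count-none (All.tabulate (λ {σ} σ∈ →
    sameSet-false (XDes X (insertAt (suc n) j σ)) I j
      (λ e → ≡true-≡false⇒≢ j∈I (XDes-insertAt-at X (suc n) (perm-tops σ∈) (≤-length σ∈ j≤n)) (sym e))))

  module Window {j : ℕ} (j<n : j < n) (j∉I : j ∈ᵇ I ≡ false) (j+1∈I : suc j ∈ᵇ I ≡ true)
    {S : List ℕ} (lo : ∀ e → e < j → e ∈ᵇ S ≡ e ∈ᵇ I) (hi : ∀ e → j < e → e ∈ᵇ S ≡ suc e ∈ᵇ I)
    where

    Q⇔AgreeOff : {σ : List ℕ} → σ ∈ perms n → Q j σ ≡ true ⇔ AgreeOff j (XDes X σ) S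
    Q⇔AgreeOff {σ} σ∈ = mk⇔
      (λ q → XDes-insertAt-≐⇒AgreeOff X (suc n) tops j< I S j∉I j+1∈I lo hi (sameSet⇒≐ Dτ I q))
      (λ σ≈S → ≐⇒sameSet Dτ I (AgreeOff⇒XDes-insertAt-≐ X (suc n) tops j< I S j∉I j+1∈I lo hi σ≈S))
      where
      Dτ : List ℕ
      Dτ = XDes X (insertAt (suc n) j σ)
      tops : All (Above X (suc n)) σ
      tops = perm-tops σ∈
      j< : j < length σ
      j< = ≤-length σ∈ j<n

  c-zero : 0 < n → 0 ∈ᵇ I ≡ false → 1 ∈ᵇ I ≡ true → {S : List ℕ} →
    (∀ e → 0 < e → e ∈ᵇ S ≡ suc e ∈ᵇ I) → 0 ∈ᵇ S ≡ false → c 0 ≡ dX X S n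
  c-zero 0<n 0∉I 1∈I {S} hi 0∉S = count-cong (All.tabulate (λ {σ} σ∈ → ⇔→≡ (mk⇔
    (λ q → ≐⇒sameSet (XDes X σ) S
             (AgreeOff⇒≐ (Equivalence.to (Q⇔AgreeOff σ∈) q) (trans (zero-∈ᵇ-XDes X σ) (sym 0∉S))))
    (λ e → Equivalence.from (Q⇔AgreeOff σ∈) (≐⇒AgreeOff (sameSet⇒≐ (XDes X σ) S e))))))
    where open Window 0<n 0∉I 1∈I {S} (λ _ ()) hi

  c-suc : {j : ℕ} → suc j < n → suc j ∈ᵇ I ≡ false → suc (suc j) ∈ᵇ I ≡ true → {S₀ S₁ : List ℕ} →
    (∀ e → e < suc j → e ∈ᵇ S₀ ≡ e ∈ᵇ I) → (∀ e → suc j < e → e ∈ᵇ S₀ ≡ suc e ∈ᵇ I) →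
    suc j ∈ᵇ S₀ ≡ false → suc j ∈ᵇ S₁ ≡ true → AgreeOff (suc j) S₀ S₁ →
    c (suc j) ≡ dX X S₀ n + dX X S₁ n
  c-suc {j} j<n j∉I j+1∈I {S₀} {S₁} lo hi j∉S₀ j∈S₁ S₀≈S₁ =
    trans (count-cong (All.tabulate split))
          (count-∨ {p = λ σ → sameSet (XDes X σ) S₀} {q = λ σ → sameSet (XDes X σ) S₁}
                   (All.tabulate {xs = perms n} (λ {σ} _ → disjoint σ)))
    where
    open Window j<n j∉I j+1∈I {S₀} lo hi

    split : {σ : List ℕ} → σ ∈ perms n →
      Q (suc j) σ ≡ sameSet (XDes X σ) S₀ ∨ sameSet (XDes X σ) S₁
    split {σ} σ∈ = ⇔→≡ (mk⇔ to from)
      where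
      D : List ℕ
      D = XDes X σ
      to : Q (suc j) σ ≡ true → sameSet D S₀ ∨ sameSet D S₁ ≡ true
      to q with Equivalence.to (Q⇔AgreeOff σ∈) q | suc j ∈ᵇ D in at
      ... | D≈S₀ | false rewrite ≐⇒sameSet D S₀ (AgreeOff⇒≐ D≈S₀ (trans at (sym j∉S₀))) = refl
      ... | D≈S₀ | true
        rewrite ≐⇒sameSet D S₁ (AgreeOff⇒≐ (AgreeOff-trans D≈S₀ S₀≈S₁) (trans at (sym j∈S₁))) =
        ∨-zeroʳ (sameSet D S₀)
      from : sameSet D S₀ ∨ sameSet D S₁ ≡ true → Q (suc j) σ ≡ true
      from e with sameSet D S₀ in e₀
      ... | true  = Equivalence.from (Q⇔AgreeOff σ∈) (≐⇒AgreeOff (sameSet⇒≐ D S₀ e₀))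
      ... | false = Equivalence.from (Q⇔AgreeOff σ∈)
                      (AgreeOff-trans (≐⇒AgreeOff (sameSet⇒≐ D S₁ e)) (AgreeOff-sym S₀≈S₁))

    disjoint : (σ : List ℕ) → sameSet (XDes X σ) S₀ ∧ sameSet (XDes X σ) S₁ ≡ false
    disjoint σ with sameSet (XDes X σ) S₀ in e₀ | sameSet (XDes X σ) S₁ in e₁
    ... | false | _     = refl
    ... | true  | false = refl
    ... | true  | true
      with () ← trans (sym j∈S₁) (trans (sym (sameSet⇒≐ (XDes X σ) S₁ e₁ (suc j)))
                                        (trans (sameSet⇒≐ (XDes X σ) S₀ e₀ (suc j)) j∉S₀))

-- Summing over the elements of I

at-∈ : (L : List ℕ) {k : ℕ} → k < length L → at L k ∈ L
at-∈ (a ∷ L) {zero}  _         = here refl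
at-∈ (a ∷ L) {suc k} (s≤s k<) = there (at-∈ L k<)

drop-at : (L : List ℕ) {k : ℕ} → k < length L → drop k L ≡ at L k ∷ drop (suc k) L
drop-at (a ∷ L) {zero}  _         = refl
drop-at (a ∷ L) {suc k} (s≤s k<) = drop-at L k<

map-at-upTo : (L : List ℕ) → map (at L) (upTo (length L)) ≡ L
map-at-upTo L = trans (map-upTo (at L) (length L)) (applyUpTo-at L)
  where
  applyUpTo-at : (L : List ℕ) → applyUpTo (at L) (length L) ≡ L
  applyUpTo-at []      = refl
  applyUpTo-at (a ∷ L) = cong (a ∷_) (applyUpTo-at L)

sorted-split : (L : List ℕ) {a : ℕ} {R : List ℕ} →
  AllPairs _<_ (L ++ a ∷ R) → All (_< a) L × All (a <_) R
sorted-split []      (a<R ∷ _) = [] , a<R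
sorted-split (x ∷ L) (x<  ∷ s) with sorted-split L s
... | L<a , a<R = All.lookup x< (∈-++⁺ʳ L (here refl)) ∷ L<a , a<R

-- The k-th element i_k = j + 1 splits I as L ++ i_k ∷ R; then Î_k = (L ∪ (R − 1)) ∖ {0} and
-- I_k = (L ∪ {j} ∪ (R − 1)) ∖ {0}.
module Pivot (I : List ℕ) (I-sorted : AllPairs _<_ I) (I-pos : All (1 ≤_) I)
             {k : ℕ} (k< : k < length I) {j : ℕ} (I[k]≡ : at I k ≡ suc j) where

  L R : List ℕ
  L = take k I
  R = drop (suc k) I

  drop≡ : drop k I ≡ suc j ∷ R
  drop≡ = trans (drop-at I k<) (cong (_∷ R) I[k]≡)

  I≡ : I ≡ L ++ suc j ∷ R
  I≡ = trans (sym (take++drop≡id k I)) (cong (L ++_) drop≡)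

  L<pivot : All (_< suc j) L
  L<pivot = proj₁ (sorted-split L (subst (AllPairs _<_) I≡ I-sorted))

  pivot<R : All (suc j <_) R
  pivot<R = proj₂ (sorted-split L (subst (AllPairs _<_) I≡ I-sorted))

  ∉ᵇ-L : {e : ℕ} → suc j ≤ e → e ∈ᵇ L ≡ false
  ∉ᵇ-L j<e = All≢⇒∈ᵇ-false (All.map (λ x<j → >⇒≢ (<-≤-trans x<j j<e)) L<pivot)

  ∉ᵇ-R : {e : ℕ} → e ≤ suc j → e ∈ᵇ R ≡ false
  ∉ᵇ-R e≤j = All≢⇒∈ᵇ-false (All.map (λ j<x → <⇒≢ (≤-<-trans e≤j j<x)) pivot<R)

  ∈ᵇ-I : (e : ℕ) → e ∈ᵇ I ≡ e ∈ᵇ L ∨ ((e ≡ᵇ suc j) ∨ e ∈ᵇ R)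
  ∈ᵇ-I e =
    trans (cong (e ∈ᵇ_) I≡) (trans (∈ᵇ-++ e L (suc j ∷ R)) (cong (e ∈ᵇ L ∨_) (∈ᵇ-∷ e (suc j) R)))

  ∈ᵇ-I-below : {e : ℕ} → e < suc j → e ∈ᵇ I ≡ e ∈ᵇ L
  ∈ᵇ-I-below {e} e<j
    rewrite ∈ᵇ-I e | ≡ᵇ-≢ (<⇒≢ e<j) | ∉ᵇ-R (<⇒≤ e<j) = ∨-identityʳ (e ∈ᵇ L)

  ∈ᵇ-I-above : {e : ℕ} → suc j < e → e ∈ᵇ I ≡ e ∈ᵇ R
  ∈ᵇ-I-above {e} j<e rewrite ∈ᵇ-I e | ∉ᵇ-L (<⇒≤ j<e) | ≡ᵇ-≢ (>⇒≢ j<e) = refl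

  pivot-∈ᵇ : suc j ∈ᵇ I ≡ true
  pivot-∈ᵇ rewrite ∈ᵇ-I (suc j) | ≡ᵇ-refl j = ∨-zeroʳ (suc j ∈ᵇ L)

  R-pos : All (1 ≤_) R
  R-pos = All.map (λ j<x → ≤-trans (s≤s z≤n) j<x) pivot<R

  ∈ᵇ-Ihat : (e : ℕ) → e ∈ᵇ Ihat I k ≡ not (e ≡ᵇ 0) ∧ (e ∈ᵇ L ∨ suc e ∈ᵇ R)
  ∈ᵇ-Ihat e = ∈ᵇ-del0-shift e L R R-pos

  ∈ᵇ-Ik : (e : ℕ) → e ∈ᵇ Ik I k ≡ not (e ≡ᵇ 0) ∧ (e ∈ᵇ L ∨ ((e ≡ᵇ j) ∨ suc e ∈ᵇ R))
  ∈ᵇ-Ik e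
    rewrite ∈ᵇ-del0-shift e L (drop k I) (All-drop⁺ k I-pos) | drop≡ | ∈ᵇ-∷ (suc e) (suc j) R = refl

  zero-∉ᵇ-I : 0 ∈ᵇ I ≡ false
  zero-∉ᵇ-I = All≢⇒∈ᵇ-false (All.map <⇒≢ I-pos)

  Ihat-below : ∀ e → e < j → e ∈ᵇ Ihat I k ≡ e ∈ᵇ I
  Ihat-below zero    _   = trans (∈ᵇ-Ihat 0) (sym zero-∉ᵇ-I)
  Ihat-below (suc e) e<j
    rewrite ∈ᵇ-Ihat (suc e) | ∉ᵇ-R (m≤n⇒m≤1+n e<j) | ∈ᵇ-I-below (m<n⇒m<1+n e<j) =
    ∨-identityʳ (suc e ∈ᵇ L)

  Ihat-above : ∀ e → j < e → e ∈ᵇ Ihat I k ≡ suc e ∈ᵇ I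
  Ihat-above (suc e) (s≤s j≤e)
    rewrite ∈ᵇ-Ihat (suc e) | ∉ᵇ-L (s≤s j≤e) | ∈ᵇ-I-above (s≤s (s≤s j≤e)) = refl

  Ihat-at : j ∈ᵇ I ≡ false → j ∈ᵇ Ihat I k ≡ false
  Ihat-at j∉I rewrite ∈ᵇ-Ihat j | sym (∈ᵇ-I-below (n<1+n j)) | j∉I | ∉ᵇ-R (≤-refl {suc j}) =
    ∧-zeroʳ (not (j ≡ᵇ 0))

  Ihat≈Ik : AgreeOff j (Ihat I k) (Ik I k)
  Ihat≈Ik = agreeOff agreement
    where
    agreement : ∀ e → e ≢ j → e ∈ᵇ Ihat I k ≡ e ∈ᵇ Ik I k
    agreement e e≢j rewrite ∈ᵇ-Ihat e | ∈ᵇ-Ik e | ≡ᵇ-≢ e≢j = refl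

  Ik-at : j ∈ᵇ Ik I k ≡ not (j ≡ᵇ 0)
  Ik-at rewrite ∈ᵇ-Ik j | ≡ᵇ-refl j | ∨-zeroʳ (j ∈ᵇ L) = ∧-identityʳ (not (j ≡ᵇ 0))

module SlotSums (X : Rel2) (n : ℕ) (H : ∀ i → 1 ≤ i → i ≤ n → Above X (suc n) i) (I : List ℕ)
                (I-linked : Linked _<_ I) (I-bounds : All (λ i → 1 ≤ i × i ≤ n) I) where

  open SlotCount X n H I

  private
    I-sorted : AllPairs _<_ I
    I-sorted = Linked⇒AllPairs <-trans I-linked

    I-pos : All (1 ≤_) I
    I-pos = All.map proj₁ I-bounds

    termIk termIhat : ℕ → ℕ
    termIk   k = if inI'' I (at I k) then dX X (Ik I k) n else 0
    termIhat k = if inI' I (at I k) then dX X (Ihat I k) n else 0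

    c-off-I : ∀ {i} → i ∈ range n → i ∉ I → c (i ∸ 1) ≡ 0
    c-off-I {i} i∈ i∉I with range-∈⁻ i∈
    c-off-I {suc j} i∈ i∉I | _ , j<n = c-vanish-next j<n (∉⇒∈ᵇ i∉I)

    module P {k : ℕ} (k< : k < length I) {j : ℕ} (I[k]≡ : at I k ≡ suc j) =
      Pivot I I-sorted I-pos k< I[k]≡

    c-pivot : (k : ℕ) → k < length I → c (at I k ∸ 1) ≡ termIk k + termIhat k
    c-pivot k k< with at I k in I[k]≡ | All.lookup I-bounds (at-∈ I k<)
    ... | suc zero | _ , 0<n rewrite P.pivot-∈ᵇ k< I[k]≡ | P.zero-∉ᵇ-I k< I[k]≡ =
      c-zero 0<n zero-∉ᵇ-I pivot-∈ᵇ {Ihat I k} Ihat-above (Ihat-at zero-∉ᵇ-I)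
      where open P k< I[k]≡
    ... | suc (suc j) | _ , j<n with suc j ∈ᵇ I in j∈?I
    ...   | true  rewrite P.pivot-∈ᵇ k< I[k]≡ = c-vanish-at (<⇒≤ j<n) j∈?I
    ...   | false rewrite P.pivot-∈ᵇ k< I[k]≡ =
      trans (c-suc j<n j∈?I pivot-∈ᵇ {Ihat I k} {Ik I k}
                   Ihat-below Ihat-above (Ihat-at j∈?I) Ik-at Ihat≈Ik)
            (+-comm (dX X (Ihat I k) n) (dX X (Ik I k) n))
      where open P k< I[k]≡

  sum-slots : sum (map c (upTo n)) ≡ sumIk X I n + sumIhat X I n
  sum-slots = begin
    sum (map c (upTo n))
      ≡⟨ cong sum (map-∘ (upTo n)) ⟩
    sum (map (λ i → c (i ∸ 1)) (range n))
      ≡⟨ sum-support (λ i → c (i ∸ 1)) (AllPairs.map <⇒≢ I-sorted) (range-Unique n)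
                     (All.map (uncurry range-∈⁺) I-bounds) c-off-I ⟩
    sum (map (λ i → c (i ∸ 1)) I)
      ≡⟨ cong sum (trans (cong (map _) (sym (map-at-upTo I))) (sym (map-∘ (upTo (length I))))) ⟩
    sum (map (λ k → c (at I k ∸ 1)) (upTo (length I)))
      ≡⟨ cong sum (map-cong-local (All.tabulate (λ k∈ → c-pivot _ (∈-upTo⁻ k∈)))) ⟩
    sum (map (λ k → termIk k + termIhat k) (upTo (length I)))
      ≡⟨ sum-map-+ termIk termIhat (upTo (length I)) ⟩
    sumIk X I n + sumIhat X I n
      ∎
    where open ≡-Reasoning

proposition2p4 : (X : Rel2) (n : ℕ) → 1 ≤ n →
    (∀ i → 1 ≤ i → i ≤ n → (X (suc n) i ≡ true) × (X i (suc n) ≡ false)) →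
    (I : List ℕ) → Linked _<_ I → All (λ i → 1 ≤ i × i ≤ n) I →
    dX X I (suc n) ≡ dX X I n + sumIk X I n + sumIhat X I n
proposition2p4 X n _ H I I-linked I-bounds = begin
  dX X I (suc n)                           ≡⟨ count-perms-suc (λ π → sameSet (XDes X π) I) n ⟩
  c n + sum (map c (upTo n))               ≡⟨ cong₂ _+_ c-last sum-slots ⟩
  dX X I n + (sumIk X I n + sumIhat X I n) ≡⟨ +-assoc (dX X I n) _ _ ⟨
  dX X I n + sumIk X I n + sumIhat X I n   ∎
  where
  open ≡-Reasoning
  open SlotCount X n H I
  open SlotSums X n H I I-linked I-bounds
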